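{- Let $E=\sum_{i=1}^{\ell}a_i\cdot 2^{x_i}+\mu\cdot y+\mu\cdot d$, where $a_1,\dots,a_\ell\in\mathbb{Z}$ and $\mu,d\in\mathbb{N}$. Let $M,k\in\mathbb{N}$ with $M\ge\max\big(1+2\log_2(\sum_{i=1}^{\ell}|a_i|+k\mu),\ 4\log_2(\mu)+8,\ d\big)$. Let $\psi(x_1,\dots,x_\ell,y)$, with $y$ ranging over $\mathbb{Z}$ and $x_1,\dots,x_\ell$ ranging over $\mathbb{N}$, be the formula $-k\cdot2^{x_1}\le y\le k\cdot 2^{x_1}\wedge\bigwedge_{i=1}^{\ell-1}(x_{i+1}\sim_i x_i+d_i)$, where each pair $(\sim_i,d_i)$ is either $(\ge,M)$ or $(=,g)$ for some $g\in\{0,\dots,M-1\}$. Let $\sim\in\{\le,=\}$. Then there is an expression $E'$ in the set $\{0,1\}\cup\{a\cdot2^{x_1}+\mu y+\mu d : a\in\{ -4^{\ell M},\dots,4^{\ell M}\}\}$ such that every assignment satisfying $\psi$ satisfies $(E\sim0\iff E'\sim0)$. -}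

module Defs where

open import Data.Nat as ℕ using (ℕ; zero; suc; _^_; _<_)
open import Data.Integer as ℤ using (ℤ; +_; -_; ∣_∣)
open import Data.Fin using (Fin; toℕ; inject₁) renaming (zero to fzero; suc to fsuc)
open import Relation.Binary.PropositionalEquality using (_≡_)
open import Data.Product using (_×_)

sumℤ : (n : ℕ) → (Fin n → ℤ) → ℤ
sumℤ zero    f = + 0
sumℤ (suc n) f = f fzero ℤ.+ sumℤ n (λ i → f (fsuc i))

sumℕ : (n : ℕ) → (Fin n → ℕ) → ℕ
sumℕ zero    f = 0
sumℕ (suc n) f = f fzero ℕ.+ sumℕ n (λ i → f (fsuc i))

pow2 : ℕ → ℤ
pow2 x = + (2 ^ x)

data Constr (M : ℕ) : Set where
  geM : Constr M
  eqG : Fin M → Constr M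

satC : {M : ℕ} → Constr M → ℕ → ℕ → Set
satC {M} geM     x' x = x ℕ.+ M ℕ.≤ x'
satC     (eqG g) x' x = x' ≡ x ℕ.+ toℕ g

data Cmp : Set where
  cle ceq : Cmp

holds : Cmp → ℤ → Set
holds cle z = z ℤ.≤ + 0
holds ceq z = z ≡ + 0

data Target (B : ℕ) : Set where
  tzero tone : Target B
  tlin : (a : ℤ) → ∣ a ∣ ℕ.≤ B → Target B

evalT : {B : ℕ} → Target B → (μ d x₁ : ℕ) → (y : ℤ) → ℤ
evalT tzero      μ d x₁ y = + 0
evalT tone       μ d x₁ y = + 1
evalT (tlin a _) μ d x₁ y = a ℤ.* pow2 x₁ ℤ.+ (+ μ) ℤ.* y ℤ.+ (+ μ) ℤ.* (+ d)

evalE : (ℓ : ℕ) → (Fin ℓ → ℤ) → (μ d : ℕ) → (Fin ℓ → ℕ) → ℤ → ℤ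
evalE ℓ a μ d x y = sumℤ ℓ (λ i → a i ℤ.* pow2 (x i)) ℤ.+ (+ μ) ℤ.* y ℤ.+ (+ μ) ℤ.* (+ d)

-- ψ(x₁,…,x_ℓ,y) with ℓ = suc n
psi : (n : ℕ) → (M k : ℕ) → (Fin n → Constr M) → (Fin (suc n) → ℕ) → ℤ → Set
psi n M k c x y =
  (- (+ (k ℕ.* 2 ^ x fzero)) ℤ.≤ y) × ((y ℤ.≤ + (k ℕ.* 2 ^ x fzero)) ×
  ((i : Fin n) → satC (c i) (x (fsuc i)) (x (inject₁ i))))

module Submission where

-- The constraints order the exponents, x₁ ≤ x₂ ≤ … ≤ x_ℓ, so the sum Σ aᵢ·2^{xᵢ}
-- can be built from the top term down. If the part above xᵢ has collapsed to a
-- single term b·2^{x_{i+1}}, then across a link x_{i+1} = xᵢ + g it merges with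
-- aᵢ·2^{xᵢ} into (aᵢ + b·2^g)·2^{xᵢ}, the coefficient growing by a factor below 2^M;
-- across a link x_{i+1} ≥ xᵢ + M a nonzero b·2^{x_{i+1}} is at least 2^M·2^{xᵢ},
-- which outweighs everything further down.
-- Hence either the sum equals b·2^{x₁} with |b| ≤ A·2^{(ℓ-1)M}, where A = Σ|aᵢ|,
-- or a fixed sign s satisfies 2^{M+L} ≤ s·Σ + A·2^L for some L ≥ x₁. In the first
-- case E′ = b·2^{x₁} + μy + μd works. In the second, |μy + μd| ≤ (kμ + μd)·2^L,
-- and the bounds on M give A + kμ + μd < 2^M, so s·E ≥ 2^L ≥ 1 and E′ can be the
-- constant 0 or 1.

open import Defs

module _ where
  open import Data.Nat
  open import Data.Nat.Properties
  open import Data.Nat.Tactic.RingSolver using (solve-∀; solve)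
  open import Data.List using (_∷_; [])
  open import Relation.Binary.PropositionalEquality using (_≡_; cong)
  open import Relation.Nullary using (yes; no; contradiction)
  open ≤-Reasoning

  n<2^n : ∀ n → n < 2 ^ n
  n<2^n zero    = s≤s z≤n
  n<2^n (suc n) = +-mono-≤ (m^n>0 2 n) (≤-trans (n<2^n n) (m≤m+n _ 0))

  n*n<64*2^n : ∀ n → n * n < 64 * 2 ^ n
  n*n<64*2^n zero    = s≤s z≤n
  n*n<64*2^n (suc n) = begin-strict
    suc n * suc n           ≡⟨ solve (n ∷ []) ⟩
    n * n + suc (2 * n)     <⟨ +-mono-<-≤ (n*n<64*2^n n) 2n+1≤64*2^n ⟩
    64 * 2 ^ n + 64 * 2 ^ n ≡⟨ twice (2 ^ n) ⟩
    64 * 2 ^ suc n          ∎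
    where
    twice : ∀ t → 64 * t + 64 * t ≡ 64 * (2 * t)
    twice = solve-∀
    2n+1≤64*2^n : suc (2 * n) ≤ 64 * 2 ^ n
    2n+1≤64*2^n = ≤-trans (*-monoʳ-< 2 (n<2^n n)) (*-monoˡ-≤ (2 ^ n) {2} {64} (s≤s (s≤s z≤n)))

  n≤n^2 : ∀ n → n ≤ n ^ 2
  n≤n^2 zero      = z≤n
  n≤n^2 n@(suc _) = m≤m*n n (n ^ 1)

  m*m<n*n⇒m<n : ∀ {m n} → m * m < n * n → m < n
  m*m<n*n⇒m<n {m} {n} m*m<n*n with m <? n
  ... | yes m<n = m<n
  ... | no  m≮n = contradiction (*-mono-≤ (≮⇒≥ m≮n) (≮⇒≥ m≮n)) (<⇒≱ m*m<n*n)

  -- Squared, the claim reads (2μd)² ≤ 4M²·μ⁴ ≤ 4M²·2^M/256 < (2^M)², using M² < 64·2^M.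
  2*μ*d<2^M : ∀ μ d M → 256 * μ ^ 4 ≤ 2 ^ M → d ≤ M → 2 * (μ * d) < 2 ^ M
  2*μ*d<2^M μ d M 256μ⁴≤2^M d≤M = m*m<n*n⇒m<n (*-cancelˡ-< 256 _ _ (begin-strict
    256 * (2 * (μ * d) * (2 * (μ * d))) ≡⟨ solve (μ ∷ d ∷ []) ⟩
    4 * (d * d) * (256 * (μ * μ))       ≤⟨ *-mono-≤ (*-monoʳ-≤ 4 (*-mono-≤ d≤M d≤M)) (*-monoʳ-≤ 256 μ²≤μ⁴) ⟩
    4 * (M * M) * (256 * μ ^ 4)          ≤⟨ *-monoʳ-≤ (4 * (M * M)) 256μ⁴≤2^M ⟩
    4 * (M * M) * 2 ^ M                  <⟨ *-monoˡ-< (2 ^ M) {{m^n≢0 2 M}} (*-monoʳ-< 4 (n*n<64*2^n M)) ⟩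
    4 * (64 * 2 ^ M) * 2 ^ M             ≡⟨ regroup (2 ^ M) ⟩
    256 * (2 ^ M * 2 ^ M)                ∎))
    where
    quartic : ∀ n → n * n * (n * n * 1) ≡ n * (n * (n * (n * 1)))
    quartic = solve-∀
    μ²≤μ⁴ : μ * μ ≤ μ ^ 4
    μ²≤μ⁴ = ≤-trans (n≤n^2 (μ * μ)) (≤-reflexive (quartic μ))
    regroup : ∀ t → 4 * (64 * t) * t ≡ 256 * (t * t)
    regroup = solve-∀

  S+μd<2^M : ∀ S μ d M → 2 * S ^ 2 ≤ 2 ^ M → 256 * μ ^ 4 ≤ 2 ^ M → d ≤ M → S + μ * d < 2 ^ M
  S+μd<2^M S μ d M 2S²≤2^M 256μ⁴≤2^M d≤M = *-cancelˡ-< 2 _ _ (begin-strict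
    2 * (S + μ * d)     ≡⟨ *-distribˡ-+ 2 S (μ * d) ⟩
    2 * S + 2 * (μ * d) <⟨ +-mono-≤-< (≤-trans (*-monoʳ-≤ 2 (n≤n^2 S)) 2S²≤2^M)
                                      (2*μ*d<2^M μ d M 256μ⁴≤2^M d≤M) ⟩
    2 ^ M + 2 ^ M       ≡⟨ cong (2 ^ M +_) (+-identityʳ (2 ^ M)) ⟨
    2 * 2 ^ M           ∎)

module _ where
  open import Data.Integer
  open import Data.Integer.Properties
  open import Data.Integer.Tactic.RingSolver using (solve-∀)
  open import Data.Nat as ℕ using (ℕ)
  import Data.Nat.Properties as ℕ
  import Data.Nat.Tactic.RingSolver as ℕ
  open import Data.Sign as Sign using (Sign)
  open import Data.Fin using (Fin; toℕ; inject₁) renaming (zero to fzero; suc to fsuc)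
  open import Data.Fin.Properties using (toℕ<n)
  open import Data.Product using (∃; _×_; _,_)
  open import Function using (_∘_; _$_)
  open import Function.Bundles using (_⇔_; mk⇔)
  open import Relation.Binary.PropositionalEquality
  open import Relation.Nullary using (¬_; contradiction; yes; no)

  sgn : Sign → ℤ
  sgn Sign.+ = 1ℤ
  sgn Sign.- = -1ℤ

  sgn[sign-i]*i≡+∣i∣ : ∀ i → sgn (sign i) * i ≡ + ∣ i ∣
  sgn[sign-i]*i≡+∣i∣ (+ n)    = *-identityˡ (+ n)
  sgn[sign-i]*i≡+∣i∣ -[1+ n ] = -1*i≡-i -[1+ n ]

  ∣sgn*i∣≡∣i∣ : ∀ s i → ∣ sgn s * i ∣ ≡ ∣ i ∣
  ∣sgn*i∣≡∣i∣ Sign.+ i = cong ∣_∣ (*-identityˡ i)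
  ∣sgn*i∣≡∣i∣ Sign.- i = trans (cong ∣_∣ (-1*i≡-i i)) (∣-i∣≡∣i∣ i)

  0≤i+∣i∣ : ∀ i → 0ℤ ≤ i + + ∣ i ∣
  0≤i+∣i∣ (+ n)    = +≤+ ℕ.z≤n
  0≤i+∣i∣ -[1+ n ] = ≤-reflexive (sym (+-inverseˡ (+ ℕ.suc n)))

  0≤sgn*i+n : ∀ s i {n} → ∣ i ∣ ℕ.≤ n → 0ℤ ≤ sgn s * i + + n
  0≤sgn*i+n s i ∣i∣≤n = ≤-trans (0≤i+∣i∣ (sgn s * i))
    (+-monoʳ-≤ (sgn s * i) (+≤+ (ℕ.≤-trans (ℕ.≤-reflexive (∣sgn*i∣≡∣i∣ s i)) ∣i∣≤n)))

  -n≤i≤n⇒∣i∣≤n : ∀ {n i} → - (+ n) ≤ i → i ≤ + n → ∣ i ∣ ℕ.≤ n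
  -n≤i≤n⇒∣i∣≤n {i = + m}                 _         (+≤+ m≤n) = m≤n
  -n≤i≤n⇒∣i∣≤n {ℕ.suc n} {i = -[1+ m ]} (-≤- m≤n) _         = ℕ.s≤s m≤n

  +-cancelʳ-≤ : ∀ {i j} k → i + k ≤ j + k → i ≤ j
  +-cancelʳ-≤ {i} {j} k i+k≤j+k = subst₂ _≤_ (cancel i) (cancel j) (+-monoˡ-≤ (- k) i+k≤j+k)
    where
    cancel : ∀ m → m + k - k ≡ m
    cancel m = trans (+-assoc m k (- k)) (trans (cong (_+_ m) (+-inverseʳ k)) (+-identityʳ m))

  pow2-+ : ∀ m n → pow2 (m ℕ.+ n) ≡ pow2 m * pow2 n
  pow2-+ m n = trans (cong +_ (ℕ.^-distribˡ-+-* 2 m n)) (pos-* (2 ℕ.^ m) (2 ℕ.^ n))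

  record Dominated (M : ℕ) (s : Sign) (S : ℤ) (A L : ℕ) : Set where
    constructor dominated
    field bound : pow2 (M ℕ.+ L) ≤ sgn s * S + + (A ℕ.* 2 ℕ.^ L)

  absorb : ∀ {M s S A L} R B → ∣ R ∣ ℕ.≤ B ℕ.* 2 ℕ.^ L → Dominated M s S A L → Dominated M s (R + S) (B ℕ.+ A) L
  absorb {M} {s} {S} {A} {L} R B ∣R∣≤B*2^L (dominated dom) = dominated $ begin
    pow2 (M ℕ.+ L)                                                     ≤⟨ dom ⟩
    sgn s * S + + (A ℕ.* 2 ℕ.^ L)                                      ≤⟨ i≤j+i _ _ {{nonNegative (0≤sgn*i+n s R ∣R∣≤B*2^L)}} ⟩
    (sgn s * R + + (B ℕ.* 2 ℕ.^ L)) + (sgn s * S + + (A ℕ.* 2 ℕ.^ L)) ≡⟨ regroup (sgn s) R S _ _ ⟩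
    sgn s * (R + S) + (+ (B ℕ.* 2 ℕ.^ L) + + (A ℕ.* 2 ℕ.^ L))          ≡⟨ cong (_+_ (sgn s * (R + S))) split ⟨
    sgn s * (R + S) + + ((B ℕ.+ A) ℕ.* 2 ℕ.^ L)                        ∎
    where
    open ≤-Reasoning
    regroup : ∀ t R S P Q → (t * R + P) + (t * S + Q) ≡ t * (R + S) + (P + Q)
    regroup = solve-∀
    split : + ((B ℕ.+ A) ℕ.* 2 ℕ.^ L) ≡ + (B ℕ.* 2 ℕ.^ L) + + (A ℕ.* 2 ℕ.^ L)
    split = trans (cong +_ (ℕ.*-distribʳ-+ (2 ℕ.^ L) B A)) (pos-+ (B ℕ.* 2 ℕ.^ L) (A ℕ.* 2 ℕ.^ L))

  1≤sgn*S : ∀ {M s S T L} → T ℕ.< 2 ℕ.^ M → Dominated M s S T L → 1ℤ ≤ sgn s * S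
  1≤sgn*S {M} {s} {S} {T} {L} T<2^M (dominated dom) =
    ≤-trans (+≤+ (ℕ.m^n>0 2 L)) (+-cancelʳ-≤ (+ (T ℕ.* 2 ℕ.^ L)) (begin
    pow2 L + + (T ℕ.* 2 ℕ.^ L)    ≡⟨ pos-+ (2 ℕ.^ L) (T ℕ.* 2 ℕ.^ L) ⟨
    + (ℕ.suc T ℕ.* 2 ℕ.^ L)       ≤⟨ +≤+ (ℕ.*-monoˡ-≤ (2 ℕ.^ L) T<2^M) ⟩
    + (2 ℕ.^ M ℕ.* 2 ℕ.^ L)       ≡⟨ cong +_ (ℕ.^-distribˡ-+-* 2 M L) ⟨
    pow2 (M ℕ.+ L)                ≤⟨ dom ⟩
    sgn s * S + + (T ℕ.* 2 ℕ.^ L) ∎))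
    where open ≤-Reasoning

  weightedSum : ∀ {n} → (Fin n → ℤ) → (Fin n → ℕ) → ℤ
  weightedSum {n} a x = sumℤ n (λ i → a i * pow2 (x i))

  absSum : ∀ {n} → (Fin n → ℤ) → ℕ
  absSum {n} a = sumℕ n (λ i → ∣ a i ∣)

  Chain : ∀ {M n} → (Fin n → Constr M) → (Fin (ℕ.suc n) → ℕ) → Set
  Chain {n = n} c x = (i : Fin n) → satC (c i) (x (fsuc i)) (x (inject₁ i))

  satC⇒≤ : ∀ {M} (c : Constr M) {x′ x} → satC c x′ x → x ℕ.≤ x′
  satC⇒≤ geM     x+M≤x′ = ℕ.m+n≤o⇒m≤o _ x+M≤x′
  satC⇒≤ (eqG g) refl   = ℕ.m≤m+n _ (toℕ g)

  data Shape {M} n (a : Fin (ℕ.suc n) → ℤ) (c : Fin n → Constr M) : Set where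
    collapse : (b : ℤ) → ∣ b ∣ ℕ.≤ absSum a ℕ.* 2 ℕ.^ (n ℕ.* M)
             → (∀ x → Chain c x → weightedSum a x ≡ b * pow2 (x fzero))
             → Shape n a c
    dominate : (s : Sign)
             → (∀ x → Chain c x → ∃ λ L → x fzero ℕ.≤ L × Dominated M s (weightedSum a x) (absSum a) L)
             → Shape n a c

  ∣a*2^x∣≤∣a∣*2^L : ∀ a {x L} → x ℕ.≤ L → ∣ a * pow2 x ∣ ℕ.≤ ∣ a ∣ ℕ.* 2 ℕ.^ L
  ∣a*2^x∣≤∣a∣*2^L a {x} x≤L =
    ℕ.≤-trans (ℕ.≤-reflexive (abs-* a (pow2 x))) (ℕ.*-monoʳ-≤ ∣ a ∣ (ℕ.^-monoʳ-≤ 2 x≤L))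

  gap-dominated : ∀ M {S x₀ x₁} b A → S ≡ b * pow2 x₁ → x₀ ℕ.+ M ℕ.≤ x₁ → b ≢ 0ℤ
                → Dominated M (sign b) S A x₀
  gap-dominated M {x₀ = x₀} {x₁} b A refl x₀+M≤x₁ b≢0 = dominated $ begin
    pow2 (M ℕ.+ x₀)                                   ≤⟨ +≤+ (ℕ.^-monoʳ-≤ 2 (subst (ℕ._≤ x₁) (ℕ.+-comm x₀ M) x₀+M≤x₁)) ⟩
    pow2 x₁                                           ≤⟨ +≤+ (ℕ.m≤n*m (2 ℕ.^ x₁) ∣ b ∣ {{≢-nonZero b≢0}}) ⟩
    + (∣ b ∣ ℕ.* 2 ℕ.^ x₁)                            ≡⟨ pos-* ∣ b ∣ (2 ℕ.^ x₁) ⟩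
    + ∣ b ∣ * pow2 x₁                                 ≡⟨ cong (_* pow2 x₁) (sgn[sign-i]*i≡+∣i∣ b) ⟨
    sgn (sign b) * b * pow2 x₁                        ≡⟨ *-assoc (sgn (sign b)) b (pow2 x₁) ⟩
    sgn (sign b) * (b * pow2 x₁)                      ≤⟨ i≤i+j _ (+ (A ℕ.* 2 ℕ.^ x₀)) ⟩
    sgn (sign b) * (b * pow2 x₁) + + (A ℕ.* 2 ℕ.^ x₀) ∎
    where open ≤-Reasoning

  collapse-eq : ∀ a b x₀ g {S x₁} → S ≡ b * pow2 x₁ → x₁ ≡ x₀ ℕ.+ g
              → a * pow2 x₀ + S ≡ (a + b * pow2 g) * pow2 x₀
  collapse-eq a b x₀ g refl refl = begin
    a * pow2 x₀ + b * pow2 (x₀ ℕ.+ g)       ≡⟨ cong (λ p → a * pow2 x₀ + b * p) (pow2-+ x₀ g) ⟩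
    a * pow2 x₀ + b * (pow2 x₀ * pow2 g)    ≡⟨ regroup a b (pow2 x₀) (pow2 g) ⟩
    (a + b * pow2 g) * pow2 x₀              ∎
    where
    open ≡-Reasoning
    regroup : ∀ a b p q → a * p + b * (p * q) ≡ (a + b * q) * p
    regroup = solve-∀

  ∣a+b*2^g∣≤ : ∀ M a b {g B e} → g ℕ.< M → ∣ b ∣ ℕ.≤ B ℕ.* 2 ℕ.^ e
             → ∣ a + b * pow2 g ∣ ℕ.≤ (∣ a ∣ ℕ.+ B) ℕ.* 2 ℕ.^ (M ℕ.+ e)
  ∣a+b*2^g∣≤ M a b {g} {B} {e} g<M ∣b∣≤B*2^e = begin
    ∣ a + b * pow2 g ∣                                  ≤⟨ ∣i+j∣≤∣i∣+∣j∣ a (b * pow2 g) ⟩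
    ∣ a ∣ ℕ.+ ∣ b * pow2 g ∣                            ≡⟨ cong (ℕ._+_ ∣ a ∣) (abs-* b (pow2 g)) ⟩
    ∣ a ∣ ℕ.+ ∣ b ∣ ℕ.* 2 ℕ.^ g                         ≤⟨ ℕ.+-mono-≤ (ℕ.m≤m*n ∣ a ∣ (2 ℕ.^ (M ℕ.+ e)) {{ℕ.m^n≢0 2 (M ℕ.+ e)}})
                                                                    ∣b∣*2^g≤ ⟩
    ∣ a ∣ ℕ.* 2 ℕ.^ (M ℕ.+ e) ℕ.+ B ℕ.* 2 ℕ.^ (M ℕ.+ e) ≡⟨ ℕ.*-distribʳ-+ (2 ℕ.^ (M ℕ.+ e)) ∣ a ∣ B ⟨
    (∣ a ∣ ℕ.+ B) ℕ.* 2 ℕ.^ (M ℕ.+ e)                   ∎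
    where
    open ℕ.≤-Reasoning
    ∣b∣*2^g≤ : ∣ b ∣ ℕ.* 2 ℕ.^ g ℕ.≤ B ℕ.* 2 ℕ.^ (M ℕ.+ e)
    ∣b∣*2^g≤ = begin
      ∣ b ∣ ℕ.* 2 ℕ.^ g             ≤⟨ ℕ.*-mono-≤ ∣b∣≤B*2^e (ℕ.^-monoʳ-≤ 2 (ℕ.<⇒≤ g<M)) ⟩
      B ℕ.* 2 ℕ.^ e ℕ.* 2 ℕ.^ M     ≡⟨ ℕ.*-assoc B (2 ℕ.^ e) (2 ℕ.^ M) ⟩
      B ℕ.* (2 ℕ.^ e ℕ.* 2 ℕ.^ M)   ≡⟨ cong (B ℕ.*_) (ℕ.*-comm (2 ℕ.^ e) (2 ℕ.^ M)) ⟩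
      B ℕ.* (2 ℕ.^ M ℕ.* 2 ℕ.^ e)   ≡⟨ cong (B ℕ.*_) (ℕ.^-distribˡ-+-* 2 M e) ⟨
      B ℕ.* 2 ℕ.^ (M ℕ.+ e)         ∎

  -- c₀ stands for c fzero, abstracted so that the clauses can match on the first link.
  extend : ∀ {M m} (a : Fin (ℕ.suc (ℕ.suc m)) → ℤ) (c : Fin (ℕ.suc m) → Constr M) (c₀ : Constr M)
         → (∀ {x} → Chain c x → satC c₀ (x (fsuc fzero)) (x fzero))
         → Shape m (a ∘ fsuc) (c ∘ fsuc) → Shape (ℕ.suc m) a c
  extend a c c₀ head (dominate s dom) = dominate s λ x ch →
    let L , x₁≤L , tail-dominated = dom (x ∘ fsuc) (ch ∘ fsuc)
        x₀≤L = ℕ.≤-trans (satC⇒≤ c₀ (head {x} ch)) x₁≤L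
    in L , x₀≤L , absorb (a fzero * pow2 (x fzero)) ∣ a fzero ∣ (∣a*2^x∣≤∣a∣*2^L (a fzero) x₀≤L) tail-dominated
  extend {M} a c (eqG g) head (collapse b ∣b∣≤ sum≡) =
    collapse (a fzero + b * pow2 (toℕ g)) (∣a+b*2^g∣≤ M (a fzero) b (toℕ<n g) ∣b∣≤) λ x ch →
      collapse-eq (a fzero) b (x fzero) (toℕ g) (sum≡ (x ∘ fsuc) (ch ∘ fsuc)) (head {x} ch)
  extend {M} {m} a c geM head (collapse b ∣b∣≤ sum≡) with b ≟ 0ℤ
  ... | yes refl = collapse (a fzero) ∣a₀∣≤ λ x ch →
    trans (cong (_+_ (a fzero * pow2 (x fzero))) (sum≡ (x ∘ fsuc) (ch ∘ fsuc))) (+-identityʳ _)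
    where
    ∣a₀∣≤ : ∣ a fzero ∣ ℕ.≤ absSum a ℕ.* 2 ℕ.^ (ℕ.suc m ℕ.* M)
    ∣a₀∣≤ = ℕ.m≤n⇒m≤n*o (2 ℕ.^ (ℕ.suc m ℕ.* M)) {{ℕ.m^n≢0 2 (ℕ.suc m ℕ.* M)}} (ℕ.m≤m+n _ _)
  ... | no b≢0 = dominate (sign b) λ x ch → x fzero , ℕ.≤-refl ,
    absorb (a fzero * pow2 (x fzero)) ∣ a fzero ∣ (∣a*2^x∣≤∣a∣*2^L (a fzero) {x fzero} ℕ.≤-refl)
      (gap-dominated M b (absSum (a ∘ fsuc)) (sum≡ (x ∘ fsuc) (ch ∘ fsuc)) (head {x} ch) b≢0)

  classify : ∀ {M} n (a : Fin (ℕ.suc n) → ℤ) (c : Fin n → Constr M) → Shape n a c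
  classify ℕ.zero    a c = collapse (a fzero) (ℕ.m≤n⇒m≤n*o 1 (ℕ.m≤m+n _ 0)) λ _ _ → +-identityʳ _
  classify (ℕ.suc m) a c = extend a c (c fzero) (λ ch → ch fzero) (classify m (a ∘ fsuc) (c ∘ fsuc))

  evalE-dominated : ∀ {M s n} (a : Fin (ℕ.suc n) → ℤ) μ d k {x y L}
                  → ∣ y ∣ ℕ.≤ k ℕ.* 2 ℕ.^ x fzero → x fzero ℕ.≤ L
                  → Dominated M s (weightedSum a x) (absSum a) L
                  → Dominated M s (evalE (ℕ.suc n) a μ d x y) (k ℕ.* μ ℕ.+ μ ℕ.* d ℕ.+ absSum a) L
  evalE-dominated {M} {s} a μ d k {x} {y} {L} ∣y∣≤ x₀≤L sum-dominated =
    subst (λ E → Dominated M s E _ L) (sym (trans (+-assoc (weightedSum a x) _ _) (+-comm (weightedSum a x) _)))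
      (absorb (+ μ * y + + μ * + d) (k ℕ.* μ ℕ.+ μ ℕ.* d) ∣μy+μd∣≤ sum-dominated)
    where
    open ℕ.≤-Reasoning
    regroup : ∀ μ k d t → μ ℕ.* (k ℕ.* t) ℕ.+ μ ℕ.* d ℕ.* t ≡ (k ℕ.* μ ℕ.+ μ ℕ.* d) ℕ.* t
    regroup = ℕ.solve-∀
    ∣μy+μd∣≤ : ∣ + μ * y + + μ * + d ∣ ℕ.≤ (k ℕ.* μ ℕ.+ μ ℕ.* d) ℕ.* 2 ℕ.^ L
    ∣μy+μd∣≤ = begin
      ∣ + μ * y + + μ * + d ∣                           ≤⟨ ∣i+j∣≤∣i∣+∣j∣ (+ μ * y) (+ μ * + d) ⟩
      ∣ + μ * y ∣ ℕ.+ ∣ + μ * + d ∣                      ≡⟨ cong₂ ℕ._+_ (abs-* (+ μ) y) (abs-* (+ μ) (+ d)) ⟩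
      μ ℕ.* ∣ y ∣ ℕ.+ μ ℕ.* d                           ≤⟨ ℕ.+-mono-≤ (ℕ.*-monoʳ-≤ μ (ℕ.≤-trans ∣y∣≤ (ℕ.*-monoʳ-≤ k (ℕ.^-monoʳ-≤ 2 x₀≤L))))
                                                                      (ℕ.m≤m*n (μ ℕ.* d) (2 ℕ.^ L) {{ℕ.m^n≢0 2 L}}) ⟩
      μ ℕ.* (k ℕ.* 2 ℕ.^ L) ℕ.+ μ ℕ.* d ℕ.* 2 ℕ.^ L     ≡⟨ regroup μ k d (2 ℕ.^ L) ⟩
      (k ℕ.* μ ℕ.+ μ ℕ.* d) ℕ.* 2 ℕ.^ L                 ∎

  1≰0 : ¬ (1ℤ ≤ 0ℤ)
  1≰0 (+≤+ ())

  signTarget : ∀ {B} → Sign → Cmp → Target B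
  signTarget _      ceq = tone
  signTarget Sign.+ cle = tone
  signTarget Sign.- cle = tzero

  holds-signTarget : ∀ {B} s ∼ {z} μ d x₀ y → 1ℤ ≤ sgn s * z
                   → holds ∼ z ⇔ holds ∼ (evalT {B} (signTarget s ∼) μ d x₀ y)
  holds-signTarget Sign.+ cle {z} _ _ _ _ 1≤z =
    mk⇔ (λ z≤0 → contradiction (≤-trans (subst (1ℤ ≤_) (*-identityˡ z) 1≤z) z≤0) 1≰0) (λ { (+≤+ ()) })
  holds-signTarget Sign.- cle {z} _ _ _ _ 1≤-z =
    mk⇔ (λ _ → ≤-refl) (λ _ → ≤-trans (neg-cancel-≤ (subst (1ℤ ≤_) (-1*i≡-i z) 1≤-z)) -≤+)
  holds-signTarget s ceq _ _ _ _ 1≤s*0 =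
    mk⇔ (λ { refl → contradiction (subst (1ℤ ≤_) (*-zeroʳ (sgn s)) 1≤s*0) 1≰0 }) (λ ())

open import Data.Nat using (ℕ; suc; _≤_; _<_; _^_; _*_; _+_; s≤s; z≤n)
open import Data.Nat.Properties
  using (≤-trans; <⇒≤; m≤m+n; +-assoc; +-comm; *-monoˡ-≤; ^-monoˡ-≤; ^-distribˡ-+-*; module ≤-Reasoning)
open import Data.Integer using (ℤ; ∣_∣; +_) renaming (_+_ to _+ℤ_; _*_ to _*ℤ_)
open import Data.Fin using (Fin; zero)
open import Data.Product using (∃; _,_)
open import Function.Bundles using (_⇔_)
open import Function.Related.Propositional using (≡⇒)
open import Relation.Binary.PropositionalEquality using (cong; subst; trans)

lemma17 : (n : ℕ) (a : Fin (suc n) → ℤ) (μ d M k : ℕ)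
            → 2 * (sumℕ (suc n) (λ i → ∣ a i ∣) + k * μ) ^ 2 ≤ 2 ^ M
            → 256 * μ ^ 4 ≤ 2 ^ M
            → d ≤ M
            → (c : Fin n → Constr M) (∼ : Cmp)
            → ∃ λ (E′ : Target (4 ^ (suc n * M)))
                → (x : Fin (suc n) → ℕ) (y : ℤ)
                → psi n M k c x y
                → holds ∼ (evalE (suc n) a μ d x y) ⇔ holds ∼ (evalT E′ μ d (x zero) y)
lemma17 n a μ d M k 2[A+kμ]²≤2^M 256μ⁴≤2^M d≤M c ∼ with classify n a c
... | collapse b ∣b∣≤A*2^nM sum≡ = tlin b ∣b∣≤4^[1+n]M , λ x y (_ , _ , chain) →
  ≡⇒ (cong (λ S → holds ∼ (S +ℤ + μ *ℤ y +ℤ + μ *ℤ + d)) (sum≡ x chain))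
  where
  open ≤-Reasoning
  A≤2^M : absSum a ≤ 2 ^ M
  A≤2^M = ≤-trans (m≤m+n (absSum a) (k * μ)) (≤-trans (m≤m+n (absSum a + k * μ) (μ * d))
            (<⇒≤ (S+μd<2^M (absSum a + k * μ) μ d M 2[A+kμ]²≤2^M 256μ⁴≤2^M d≤M)))
  ∣b∣≤4^[1+n]M : ∣ b ∣ ≤ 4 ^ (suc n * M)
  ∣b∣≤4^[1+n]M = begin
    ∣ b ∣                  ≤⟨ ∣b∣≤A*2^nM ⟩
    absSum a * 2 ^ (n * M) ≤⟨ *-monoˡ-≤ (2 ^ (n * M)) A≤2^M ⟩
    2 ^ M * 2 ^ (n * M)    ≡⟨ ^-distribˡ-+-* 2 M (n * M) ⟨
    2 ^ (suc n * M)        ≤⟨ ^-monoˡ-≤ (suc n * M) (s≤s (s≤s z≤n)) ⟩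
    4 ^ (suc n * M)        ∎
... | dominate s dom = signTarget s ∼ , λ x y (-k2^x≤y , y≤k2^x , chain) →
  let L , x₀≤L , sum-dominated = dom x chain
  in holds-signTarget s ∼ μ d (x zero) y (1≤sgn*S kμ+μd+A<2^M
       (evalE-dominated a μ d k {x} (-n≤i≤n⇒∣i∣≤n -k2^x≤y y≤k2^x) x₀≤L sum-dominated))
  where
  kμ+μd+A<2^M : k * μ + μ * d + absSum a < 2 ^ M
  kμ+μd+A<2^M = subst (_< 2 ^ M) (trans (+-assoc (absSum a) (k * μ) (μ * d)) (+-comm (absSum a) (k * μ + μ * d)))
                  (S+μd<2^M (absSum a + k * μ) μ d M 2[A+kμ]²≤2^M 256μ⁴≤2^M d≤M)
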